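{- Let $\phi$ be an unsatisfiable linear $r$-CNF formula. If there is a $(k+r-1)$-winning strategy for $\phi$, then $\mathrm{Space}(\phi)\ge k-1$.
   Context: Linear clauses are disjunctions of linear literals $f=\alpha$ ($f$ a linear form over $\mathbb{F}_2$, $\alpha\in\{0,1\}$); a linear $r$-CNF is a conjunction of linear clauses each with at most $r$ linear literals. $\mathrm{Res}(\oplus)$ rules: from $A\lor(f=0)$ and $B\lor(f=1)$ derive $A\lor B$; from $C$ derive any linear clause semantically implied by $C$. A refutation is a sequence of configurations (sets of linear clauses) $S_1=\emptyset,\dots,S_m$ with $S_m$ containing the empty clause, each obtained from the previous by download (add a clause of $\phi$), erasure (remove a clause), or inference (add a clause derived by the rules from clauses in the current configuration); its space is $\max_i|S_i|$, and $\mathrm{Space}(\phi)$ is the minimum space of a $\mathrm{Res}(\oplus)$ refutation of $\phi$. For linear systems, $|\mathcal{F}|$ is the number of equations and $\mathcal{F}\vDash\mathcal{G}$ means every solution of $\mathcal{F}$ solves $\mathcal{G}$. A non-empty family $\mathcal{H}$ of linear systems over $\mathbb{F}_2$ in the variables of $\phi$ is a $K$-winning strategy if: (1) every $\mathcal{F}\in\mathcal{H}$ has $|\mathcal{F}|\le K$; (2) for every $\mathcal{F}\in\mathcal{H}$ and every clause $C$ of $\phi$ some solution of $\mathcal{F}$ satisfies $C$; (3) if $|\mathcal{G}|\le K$ and $\mathcal{F}\vDash\mathcal{G}$ for some $\mathcal{F}\in\mathcal{H}$, then $\mathcal{G}\in\mathcal{H}$; (4) for every $\mathcal{F}\in\mathcal{H}$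 with $|\mathcal{F}|<K$ and every linear form $f$ there is $a\in\mathbb{F}_2$ with $\mathcal{F}\land(f=a)\in\mathcal{H}$. -}

module Defs where

open import Data.Bool using (Bool; true; false; _xor_; _∧_; T)
open import Data.Nat using (ℕ; zero; suc; _≤_; _<_; _⊔_)
open import Data.Fin using (Fin; zero; suc)
open import Data.Vec using (Vec; []; _∷_)
open import Data.List using (List; []; _∷_; _++_; length)
open import Data.List.Membership.Propositional using (_∈_)
open import Data.List.Relation.Unary.All using (All)
open import Data.List.Relation.Unary.Any using (Any)
open import Data.Product using (Σ; ∃; _×_; _,_)
open import Relation.Binary.PropositionalEquality using (_≡_)
open import Relation.Nullary using (¬_)
open import Function.Bundles using (_⇔_)

LinForm : ℕ → Set
LinForm n = Vec Bool n

Assignment : ℕ → Set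
Assignment n = Fin n → Bool

eval : ∀ {n} → LinForm n → Assignment n → Bool
eval []       a = false
eval (c ∷ cs) a = (c ∧ a zero) xor eval cs (λ i → a (suc i))

LinLit : ℕ → Set
LinLit n = LinForm n × Bool

holds : ∀ {n} → LinLit n → Assignment n → Set
holds (f , α) a = eval f a ≡ α

Clause : ℕ → Set
Clause n = List (LinLit n)

satC : ∀ {n} → Clause n → Assignment n → Set
satC C a = Any (λ ℓ → holds ℓ a) C

-- Clauses are sets of literals: equality as sets.
_≈C_ : ∀ {n} → Clause n → Clause n → Set
C ≈C D = ∀ ℓ → (ℓ ∈ C) ⇔ (ℓ ∈ D)

CNF : ℕ → Set
CNF n = List (Clause n)

satF : ∀ {n} → CNF n → Assignment n → Set
satF φ a = All (λ C → satC C a) φ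

IsLinearRCNF : ∀ {n} → ℕ → CNF n → Set
IsLinearRCNF r φ = All (λ C → length C ≤ r) φ

Unsatisfiable : ∀ {n} → CNF n → Set
Unsatisfiable {n} φ = ¬ (Σ (Assignment n) λ a → satF φ a)

Config : ℕ → Set
Config n = List (Clause n)

data Resolvent {n} (C₁ C₂ D : Clause n) : Set where
  resolve : (f : LinForm n) (A B : Clause n) →
            C₁ ≈C ((f , false) ∷ A) → C₂ ≈C ((f , true) ∷ B) →
            D ≈C (A ++ B) → Resolvent C₁ C₂ D

data Derivable {n} (S : Config n) (D : Clause n) : Set where
  res    : ∀ {C₁ C₂} → C₁ ∈ S → C₂ ∈ S → Resolvent C₁ C₂ D → Derivable S D
  weaken : ∀ {C} → C ∈ S → (∀ a → satC C a → satC D a) → Derivable S D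

data Step {n} (φ : CNF n) : Config n → Config n → Set where
  download : ∀ {S C} → C ∈ φ → Step φ S (C ∷ S)
  erase    : ∀ xs C ys → Step φ (xs ++ C ∷ ys) (xs ++ ys)
  infer    : ∀ {S D} → Derivable S D → Step φ S (D ∷ S)

data Path {n} (φ : CNF n) : Config n → Set where
  done : ∀ {S} → [] ∈ S → Path φ S
  step : ∀ {S S'} → Step φ S S' → Path φ S' → Path φ S

space : ∀ {n} {φ : CNF n} {S} → Path φ S → ℕ
space {S = S} (done _)   = length S
space {S = S} (step _ p) = length S ⊔ space p

Refutation : ∀ {n} → CNF n → Set
Refutation φ = Path φ []

LinSys : ℕ → Set
LinSys n = List (LinLit n)

solves : ∀ {n} → Assignment n → LinSys n → Set
solves a F = All (λ e → holds e a) F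

_⊨_ : ∀ {n} → LinSys n → LinSys n → Set
F ⊨ G = ∀ a → solves a F → solves a G

record IsWinning {n} (φ : CNF n) (K : ℕ) (H : LinSys n → Set) : Set where
  field
    nonEmpty : Σ (LinSys n) H
    bounded  : ∀ F → H F → length F ≤ K
    consistentWithClauses :
      ∀ F → H F → ∀ C → C ∈ φ → Σ (Assignment n) λ a → solves a F × satC C a
    closedImplied : ∀ F G → H F → length G ≤ K → F ⊨ G → H G
    extendable : ∀ F → H F → length F < K → ∀ (f : LinForm n) →
                 Σ Bool λ α → H ((f , α) ∷ F)

{-# OPTIONS --safe #-}

-- Along a refutation we keep, next to the configuration C₁ … Cₘ, a system e₁ … eₘ ∈ H of single
-- equations with eᵢ ⊨ Cᵢ.  Erasing a clause drops its equation.  An inferred clause D is entailed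
-- by the system, and a linear clause entailed by a linear system is already implied by a single
-- entailed equation: if the system entails neither f = β nor g = γ but their disjunction, then
-- since its solution set is affine it entails f + g = β + γ + 1.  A downloaded clause C is answered
-- by first fixing the ≤ r linear forms of C (extendability), then taking a literal of C true at a
-- solution (consistency), which the enlarged system then entails.  While m ≤ k all these systems
-- have at most k + r equations, and a system in H is satisfiable, so the empty clause never
-- appears.  A (k + r)-winning strategy thus forces space > k, one more than the theorem asks for.

module Submission where

open import Defs
open import Algebra using (CommutativeRing)
open import Data.Bool using (Bool; true; false; not; _xor_; _∧_)
open import Data.Bool.Properties
  using (_≟_; ¬-not; not-¬; not-injective; not-involutive; not-distribˡ-xor; not-distribʳ-xor;
         xor-assoc; xor-comm; xor-same; ∧-distribˡ-xor; ∧-distribʳ-xor; xor-∧-commutativeRing)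
open import Data.Fin using (zero; suc)
open import Data.List using (List; []; _∷_; _++_; length)
open import Data.List.Membership.Propositional using (_∈_; find; lose)
open import Data.List.Relation.Binary.Pointwise using (Pointwise; []; _∷_; Pointwise-length)
open import Data.List.Relation.Binary.Sublist.Propositional as Sublist using (_∷ʳ_; _∷_; ⊆-refl)
open import Data.List.Relation.Binary.Sublist.Propositional.Properties using (All-resp-⊆)
open import Data.List.Relation.Binary.Subset.Propositional.Properties using (Any-resp-⊆)
open import Data.List.Relation.Unary.All as All using (All; []; _∷_)
open import Data.List.Relation.Unary.Any using (here; there)
open import Data.List.Relation.Unary.Any.Properties using (++⁺ˡ; ++⁺ʳ)
open import Data.Nat using (ℕ; zero; suc; _+_; _∸_; _≤_; _<_; z≤n; z<s)
open import Data.Nat.Properties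
  using (≤-refl; ≤-reflexive; ≤-trans; ≤-<-trans; <⇒≤; ≰⇒>; m≤m+n; m<m+n; m≤m⊔n; m≤n⊔m; +-suc; +-mono-<-≤)
open import Data.Product using (Σ; _×_; _,_; proj₁)
open import Data.Sum using (_⊎_; inj₁; inj₂; [_,_]′)
open import Data.Vec using ([]; _∷_; replicate; zipWith)
open import Effect.Monad using (RawMonad)
open import Function using (_∘_; id)
open import Function.Bundles using (Equivalence)
open import Level using (0ℓ)
open import Relation.Binary.PropositionalEquality
  using (_≡_; _≢_; refl; sym; trans; cong; cong₂; subst; module ≡-Reasoning)
open import Relation.Nullary using (¬_; yes; no; contradiction)
open import Relation.Nullary.Decidable using (decidable-stable)
open import Relation.Nullary.Negation using (¬¬-Monad)

open import Algebra.Properties.CommutativeSemigroup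
  (CommutativeRing.+-commutativeSemigroup xor-∧-commutativeRing) using (interchange)
open RawMonad (¬¬-Monad {0ℓ}) using (pure; _>>=_)
open ≡-Reasoning

xor-cancelˡ : ∀ x y → x xor (x xor y) ≡ y
xor-cancelˡ x y = trans (sym (xor-assoc x x y)) (cong (_xor y) (xor-same x))

xor-cancel-outer : ∀ x y → x xor (y xor x) ≡ y
xor-cancel-outer x y = trans (cong (x xor_) (xor-comm y x)) (xor-cancelˡ x y)

xor≡not-xor⇒ : ∀ {x y β γ} → x xor y ≡ not (β xor γ) → x ≡ β ⊎ y ≡ γ
xor≡not-xor⇒ {true}  {β = true}  _ = inj₁ refl
xor≡not-xor⇒ {false} {β = false} _ = inj₁ refl
xor≡not-xor⇒ {true}  {β = false} h = inj₂ (not-injective h)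
xor≡not-xor⇒ {false} {β = true} {γ} h = inj₂ (trans h (not-involutive γ))

exactly-one⇒xor≡not-xor : ∀ {x y β γ} → x ≡ β ⊎ y ≡ γ → ¬ (x ≡ β × y ≡ γ) →
                          x xor y ≡ not (β xor γ)
exactly-one⇒xor≡not-xor {x} {γ = γ} (inj₁ refl) ¬both =
  trans (cong (x xor_) (¬-not λ y≡γ → ¬both (refl , y≡γ))) (sym (not-distribʳ-xor x γ))
exactly-one⇒xor≡not-xor {y = y} {β} (inj₂ refl) ¬both =
  trans (cong (_xor y) (¬-not λ x≡β → ¬both (x≡β , refl))) (sym (not-distribˡ-xor β y))

_+ᶠ_ : ∀ {n} → LinForm n → LinForm n → LinForm n
_+ᶠ_ = zipWith _xor_

_+ᵃ_ : ∀ {n} → Assignment n → Assignment n → Assignment n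
(a +ᵃ b) i = a i xor b i

eval-zero : ∀ {n} (a : Assignment n) → eval (replicate n false) a ≡ false
eval-zero {zero}  a = refl
eval-zero {suc n} a = eval-zero (a ∘ suc)

eval-+ᶠ : ∀ {n} (f g : LinForm n) (a : Assignment n) → eval (f +ᶠ g) a ≡ eval f a xor eval g a
eval-+ᶠ []      []      a = refl
eval-+ᶠ (c ∷ f) (d ∷ g) a = begin
  ((c xor d) ∧ a zero) xor eval (f +ᶠ g) (a ∘ suc)
    ≡⟨ cong₂ _xor_ (∧-distribʳ-xor (a zero) c d) (eval-+ᶠ f g (a ∘ suc)) ⟩
  ((c ∧ a zero) xor (d ∧ a zero)) xor (eval f (a ∘ suc) xor eval g (a ∘ suc))
    ≡⟨ interchange (c ∧ a zero) (d ∧ a zero) (eval f (a ∘ suc)) (eval g (a ∘ suc)) ⟩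
  ((c ∧ a zero) xor eval f (a ∘ suc)) xor ((d ∧ a zero) xor eval g (a ∘ suc)) ∎

eval-+ᵃ : ∀ {n} (f : LinForm n) (a b : Assignment n) → eval f (a +ᵃ b) ≡ eval f a xor eval f b
eval-+ᵃ []      a b = refl
eval-+ᵃ (c ∷ f) a b = begin
  (c ∧ (a zero xor b zero)) xor eval f ((a ∘ suc) +ᵃ (b ∘ suc))
    ≡⟨ cong₂ _xor_ (∧-distribˡ-xor c (a zero) (b zero)) (eval-+ᵃ f (a ∘ suc) (b ∘ suc)) ⟩
  ((c ∧ a zero) xor (c ∧ b zero)) xor (eval f (a ∘ suc) xor eval f (b ∘ suc))
    ≡⟨ interchange (c ∧ a zero) (c ∧ b zero) (eval f (a ∘ suc)) (eval f (b ∘ suc)) ⟩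
  ((c ∧ a zero) xor eval f (a ∘ suc)) xor ((c ∧ b zero) xor eval f (b ∘ suc)) ∎

eval-+ᵃ³ : ∀ {n} (f : LinForm n) (a b c : Assignment n) →
           eval f (a +ᵃ (b +ᵃ c)) ≡ eval f a xor (eval f b xor eval f c)
eval-+ᵃ³ f a b c = trans (eval-+ᵃ f a (b +ᵃ c)) (cong (eval f a xor_) (eval-+ᵃ f b c))

solves-affine : ∀ {n} {F : LinSys n} {a b c} → solves a F → solves b F → solves c F →
                solves (a +ᵃ (b +ᵃ c)) F
solves-affine []       []       []       = []
solves-affine {F = (f , α) ∷ _} {a} {b} {c} (p ∷ ps) (q ∷ qs) (r ∷ rs) =
  trans (eval-+ᵃ³ f a b c) (trans (cong₂ _xor_ p (cong₂ _xor_ q r)) (xor-cancel-outer α α))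
  ∷ solves-affine ps qs rs

_⊨ᵉ_ : ∀ {n} → LinSys n → LinLit n → Set
F ⊨ᵉ e = ∀ a → solves a F → holds e a

_⊨ᶜ_ : ∀ {n} → LinSys n → Clause n → Set
F ⊨ᶜ C = ∀ a → solves a F → satC C a

_⇒ᶜ_ : ∀ {n} → LinLit n → Clause n → Set
e ⇒ᶜ C = ∀ a → holds e a → satC C a

module _ {n} {F : LinSys n} {f g : LinForm n} {β γ : Bool}
         (cover : ∀ a → solves a F → eval f a ≡ β ⊎ eval g a ≡ γ) where

  sum-entailed : ∀ {a₁ a₂} → solves a₁ F → eval f a₁ ≢ β →
                 solves a₂ F → eval g a₂ ≢ γ →
                 F ⊨ᵉ (f +ᶠ g , not (β xor γ))
  sum-entailed {a₁} {a₂} s₁ f₁≢β s₂ g₂≢γ a s =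
    trans (eval-+ᶠ f g a) (exactly-one⇒xor≡not-xor (cover a s) not-both)
    where
    g₁≡γ : eval g a₁ ≡ γ
    g₁≡γ = [ (λ f₁≡β → contradiction f₁≡β f₁≢β) , id ]′ (cover a₁ s₁)
    f₂≡β : eval f a₂ ≡ β
    f₂≡β = [ id , (λ g₂≡γ → contradiction g₂≡γ g₂≢γ) ]′ (cover a₂ s₂)
    -- If a satisfied both literals, the solution a + a₁ + a₂ would satisfy neither.
    not-both : ¬ (eval f a ≡ β × eval g a ≡ γ)
    not-both (f≡β , g≡γ) =
      [ f₁≢β ∘ trans (sym f-shift) , g₂≢γ ∘ trans (sym g-shift) ]′
        (cover (a +ᵃ (a₁ +ᵃ a₂)) (solves-affine s s₁ s₂))
      where
      f-shift : eval f (a +ᵃ (a₁ +ᵃ a₂)) ≡ eval f a₁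
      f-shift = begin
        eval f (a +ᵃ (a₁ +ᵃ a₂))
          ≡⟨ eval-+ᵃ³ f a a₁ a₂ ⟩
        eval f a xor (eval f a₁ xor eval f a₂)
          ≡⟨ cong₂ (λ u v → u xor (eval f a₁ xor v)) f≡β f₂≡β ⟩
        β xor (eval f a₁ xor β)
          ≡⟨ xor-cancel-outer β (eval f a₁) ⟩
        eval f a₁ ∎
      g-shift : eval g (a +ᵃ (a₁ +ᵃ a₂)) ≡ eval g a₂
      g-shift = begin
        eval g (a +ᵃ (a₁ +ᵃ a₂))
          ≡⟨ eval-+ᵃ³ g a a₁ a₂ ⟩
        eval g a xor (eval g a₁ xor eval g a₂)
          ≡⟨ cong₂ (λ u v → u xor (v xor eval g a₂)) g≡γ g₁≡γ ⟩
        γ xor (γ xor eval g a₂)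
          ≡⟨ xor-cancelˡ γ (eval g a₂) ⟩
        eval g a₂ ∎

  -- Entailment by a system is not decided here, hence the double negation; the space argument
  -- only ever derives ⊥ from it.
  entailed-disjunction⇒entailed-equation :
    ¬ ¬ (Σ (LinLit n) λ e → F ⊨ᵉ e ×
           (∀ a → holds e a → eval f a ≡ β ⊎ eval g a ≡ γ))
  entailed-disjunction⇒entailed-equation ¬goal = ¬goal ((f , β) , f-entailed , λ _ → inj₁)
    where
    g-entailed : ∀ {a₁} → solves a₁ F → eval f a₁ ≢ β → F ⊨ᵉ (g , γ)
    g-entailed {a₁} s₁ f₁≢β a₂ s₂ = decidable-stable (eval g a₂ ≟ γ) λ g₂≢γ →
      ¬goal ((f +ᶠ g , not (β xor γ)) , sum-entailed {a₁} {a₂} s₁ f₁≢β s₂ g₂≢γ ,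
             λ a h → xor≡not-xor⇒ (trans (sym (eval-+ᶠ f g a)) h))
    f-entailed : F ⊨ᵉ (f , β)
    f-entailed a₁ s₁ = decidable-stable (eval f a₁ ≟ β) λ f₁≢β →
      ¬goal ((g , γ) , g-entailed {a₁} s₁ f₁≢β , λ _ → inj₂)

entails-or-literal : ∀ {n} {F : LinSys n} {f β e} → ((f , not β) ∷ F) ⊨ᵉ e →
                     ∀ a → solves a F → eval f a ≡ β ⊎ holds e a
entails-or-literal {f = f} {β} F′⊨e a s with eval f a ≟ β
... | yes f≡β = inj₁ f≡β
... | no  f≢β = inj₂ (F′⊨e a (¬-not f≢β ∷ s))

entailed-clause⇒entailed-equation : ∀ {n} (C : Clause n) {F : LinSys n} → F ⊨ᶜ C →
                                    ¬ ¬ (Σ (LinLit n) λ e → F ⊨ᵉ e × e ⇒ᶜ C)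
entailed-clause⇒entailed-equation {n} [] F⊨[] =
  pure ((replicate n false , true) , (λ a s → contradiction (F⊨[] a s) λ ()) ,
        λ a 0≡1 → contradiction (trans (sym (eval-zero a)) 0≡1) λ ())
entailed-clause⇒entailed-equation ((f , β) ∷ C) {F} F⊨ = do
  ((g , γ) , F′⊨g , g⇒C) ← entailed-clause⇒entailed-equation C F′⊨C
  (e , F⊨e , e⇒f∨g) ← entailed-disjunction⇒entailed-equation {F = F} {f} {g} {β} {γ}
                           (entails-or-literal {e = g , γ} F′⊨g)
  pure (e , F⊨e , λ a h → [ here , there ∘ g⇒C a ]′ (e⇒f∨g a h))
  where
  F′⊨C : ((f , not β) ∷ F) ⊨ᶜ C
  F′⊨C a (f≡¬β ∷ s) with F⊨ a s
  ... | here f≡β = contradiction f≡¬β (not-¬ f≡β)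
  ... | there sat = sat

resolvent-sound : ∀ {n} {C₁ C₂ D : Clause n} {a} →
                  Resolvent C₁ C₂ D → satC C₁ a → satC C₂ a → satC D a
resolvent-sound {a = a} (resolve f A B C₁≈ C₂≈ D≈) sat₁ sat₂ =
  Any-resp-⊆ (Equivalence.from (D≈ _)) (merge (Any-resp-⊆ (Equivalence.to (C₁≈ _)) sat₁)
                                              (Any-resp-⊆ (Equivalence.to (C₂≈ _)) sat₂))
  where
  merge : satC ((f , false) ∷ A) a → satC ((f , true) ∷ B) a → satC (A ++ B) a
  merge (here f≡0)    (here f≡1)    = contradiction (trans (sym f≡0) f≡1) λ ()
  merge (there A-sat) _             = ++⁺ˡ A-sat
  merge (here _)      (there B-sat) = ++⁺ʳ A B-sat

derivable-sound : ∀ {n} {S : Config n} {D a} →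
                  Derivable S D → All (λ C → satC C a) S → satC D a
derivable-sound (res C₁∈S C₂∈S r) sat =
  resolvent-sound r (All.lookup sat C₁∈S) (All.lookup sat C₂∈S)
derivable-sound (weaken C∈S C⇒D)  sat = C⇒D _ (All.lookup sat C∈S)

Pointwise-erase : ∀ {A B : Set} {R : A → B → Set} xs {y ys} {zs : List A} →
                  Pointwise R zs (xs ++ y ∷ ys) →
                  Σ (List A) λ zs′ → Pointwise R zs′ (xs ++ ys) × zs′ Sublist.⊆ zs
Pointwise-erase []       (_ ∷ rs) = _ , rs , _ ∷ʳ ⊆-refl
Pointwise-erase (_ ∷ xs) (r ∷ rs) with Pointwise-erase xs rs
... | zs′ , rs′ , zs′⊆zs = _ , r ∷ rs′ , refl ∷ zs′⊆zs

Tracks : ∀ {n} → LinSys n → Config n → Set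
Tracks = Pointwise _⇒ᶜ_

tracks-sound : ∀ {n} {E : LinSys n} {S a} → Tracks E S → solves a E → All (λ C → satC C a) S
tracks-sound []           []      = []
tracks-sound (e⇒C ∷ tr) (h ∷ s) = e⇒C _ h ∷ tracks-sound tr s

length≤space : ∀ {n} {φ : CNF n} {S} (p : Path φ S) → length S ≤ space p
length≤space (done _)   = ≤-refl
length≤space (step _ p) = m≤m⊔n _ (space p)

Fixes : ∀ {n} → LinSys n → LinForm n → Set
Fixes G f = Σ Bool λ α → G ⊨ᵉ (f , α)

winning-satisfiable : ∀ {n} {φ : CNF n} {K H} → Unsatisfiable φ → IsWinning φ K H →
                      ∀ {F} → H F → Σ (Assignment n) λ a → solves a F
winning-satisfiable {φ = []}    unsat _ _   = contradiction ((λ _ → false) , []) unsat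
winning-satisfiable {φ = C ∷ _} _     W F∈H =
  let a , s , _ = IsWinning.consistentWithClauses W _ F∈H C (here refl) in a , s

module Winning {n} {φ : CNF n} {K} {H : LinSys n → Set} (W : IsWinning φ K H) where
  open IsWinning W

  contains-empty : H []
  contains-empty = let F , F∈H = nonEmpty in closedImplied F [] F∈H z≤n λ _ _ → []

  fix-forms : ∀ (C : Clause n) {G} → H G → length G + length C ≤ K →
              Σ (LinSys n) λ G′ → H G′ × G′ ⊨ G × All (Fixes G′ ∘ proj₁) C
  fix-forms []            G∈H _ = _ , G∈H , (λ _ s → s) , []
  fix-forms ((f , _) ∷ C) {G} G∈H le with extendable G G∈H (≤-trans (m<m+n (length G) z<s) le) f
  ... | α , fG∈H with fix-forms C fG∈H (subst (_≤ K) (+-suc (length G) (length C)) le)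
  ...   | G′ , G′∈H , G′⊨fG , fixed =
    G′ , G′∈H , (λ a → All.tail ∘ G′⊨fG a) ,
    (α , λ a → All.head ∘ G′⊨fG a) ∷ fixed

  answer-clause : ∀ {E C} → H E → C ∈ φ → length E + length C < K →
                  Σ (LinLit n) λ e → e ⇒ᶜ C × H (e ∷ E)
  answer-clause {E} {C} E∈H C∈φ lt with fix-forms C E∈H (<⇒≤ lt)
  ... | G , G∈H , G⊨E , fixed with consistentWithClauses G G∈H C C∈φ
  ... | a , sa , C-sat with find C-sat
  ... | (f , β) , l∈C , fa≡β with All.lookup fixed l∈C
  ... | α , G⊨fα =
    (f , β) , (λ _ → lose l∈C) , closedImplied G ((f , β) ∷ E) G∈H E<K G⊨fβ∷E
    where
    E<K : length E < K
    E<K = ≤-<-trans (m≤m+n (length E) (length C)) lt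
    G⊨fβ∷E : G ⊨ ((f , β) ∷ E)
    G⊨fβ∷E b sb = trans (G⊨fα b sb) (trans (sym (G⊨fα a sa)) fa≡β) ∷ G⊨E b sb

module SpaceGame {n r k} {φ : CNF n} {H : LinSys n → Set}
                 (φ-r : IsLinearRCNF r φ) (unsat : Unsatisfiable φ) (W : IsWinning φ (k + r) H) where
  open IsWinning W
  open Winning W

  tracked-length : ∀ {E : LinSys n} {S} → Tracks E S → length S ≤ k → length E ≤ k + r
  tracked-length tr S≤k =
    ≤-trans (≤-reflexive (Pointwise-length tr)) (≤-trans S≤k (m≤m+n k r))

  track-entailed : ∀ {E : LinSys n} {S e C} → Tracks E S → H E → E ⊨ᵉ e → e ⇒ᶜ C →
                   length (C ∷ S) ≤ k → Σ (LinSys n) λ E′ → Tracks E′ (C ∷ S) × H E′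
  track-entailed {E} {e = e} tr E∈H E⊨e e⇒C CS≤k =
    e ∷ E , e⇒C ∷ tr ,
    closedImplied E (e ∷ E) E∈H (tracked-length {e ∷ E} (e⇒C ∷ tr) CS≤k)
      λ a s → E⊨e a s ∷ s

  respond : ∀ {S S′ E} → Step φ S S′ → Tracks E S → H E → length S′ ≤ k →
            ¬ ¬ (Σ (LinSys n) λ E′ → Tracks E′ S′ × H E′)
  respond {E = E} (download {C = C} C∈φ) tr E∈H S′≤k =
    let e , e⇒C , eE∈H = answer-clause E∈H C∈φ (+-mono-<-≤ E<k (All.lookup φ-r C∈φ))
    in pure (e ∷ E , e⇒C ∷ tr , eE∈H)
    where
    E<k : length E < k
    E<k = subst (_< k) (sym (Pointwise-length tr)) S′≤k
  respond (erase xs _ _) tr E∈H S′≤k with Pointwise-erase xs tr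
  ... | E′ , tr′ , E′⊆E =
    pure (E′ , tr′ , closedImplied _ E′ E∈H (tracked-length tr′ S′≤k) λ _ →
                       All-resp-⊆ E′⊆E)
  respond (infer {D = D} D-derivable) tr E∈H S′≤k = do
    (e , E⊨e , e⇒D) ← entailed-clause⇒entailed-equation D
                         (λ a → derivable-sound D-derivable ∘ tracks-sound tr)
    pure (track-entailed {e = e} tr E∈H E⊨e e⇒D S′≤k)

  refutation-exceeds-space : ∀ {S E} (p : Path φ S) → Tracks E S → H E → ¬ (space p ≤ k)
  refutation-exceeds-space (done []∈S) tr E∈H _ =
    let a , s = winning-satisfiable unsat W E∈H
    in contradiction (All.lookup (tracks-sound tr s) []∈S) λ ()
  refutation-exceeds-space (step s p) tr E∈H le =
    respond s tr E∈H (≤-trans (length≤space p) p≤k) λ (E′ , tr′ , E′∈H) →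
      refutation-exceeds-space p tr′ E′∈H p≤k
    where
    p≤k : space p ≤ k
    p≤k = ≤-trans (m≤n⊔m _ (space p)) le

space-lower-bound : ∀ {n r k} {φ : CNF n} {H : LinSys n → Set} →
                    IsLinearRCNF r φ → Unsatisfiable φ → IsWinning φ (k + r) H →
                    (π : Refutation φ) → k < space π
space-lower-bound φ-r unsat W π =
  ≰⇒> (SpaceGame.refutation-exceeds-space φ-r unsat W π [] (Winning.contains-empty W))

lemma4p6 : (n r k : ℕ) (φ : CNF n) → IsLinearRCNF r φ → Unsatisfiable φ →
           (H : LinSys n → Set) → IsWinning φ (k + r ∸ 1) H →
           (π : Refutation φ) → k ∸ 1 ≤ space π
lemma4p6 n r zero    φ φ-r unsat H W π = z≤n
lemma4p6 n r (suc k) φ φ-r unsat H W π = <⇒≤ (space-lower-bound φ-r unsat W π)
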